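{- Let $p$ be a prime and let $f\in\mathbb{F}_p[x_1,\dots,x_n]$ be a homogeneous polynomial of degree at most $p-1$. Let $Z=\{x\in\mathbb{F}_p^n: f(x)=0\}$ and let $a\in\mathbb{F}_p\setminus\{0\}$ be such that $S=\{x\in\mathbb{F}_p^n: f(x)=a\}$ is nonempty. Then the $p$-dimensional rectangle $Z\times S\times\cdots\times S$ contains no line $\ell_{x,d}$ with direction $d\in Z$.
   Context: Identify $\mathbb{F}_p$ with $\{0,1,\dots,p-1\}$. The line through $x\in\mathbb{F}_p^n$ in direction $d\in\mathbb{F}_p^n$ is the sequence $\ell_{x,d}=(x+\lambda d)_{\lambda\in\mathbb{F}_p}$; a rectangle $T_1\times\cdots\times T_p$ contains $\ell_{x,d}$ if $x+\lambda d\in T_{\lambda+1}$ for every $\lambda\in\{0,\dots,p-1\}$. -}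

module Defs where

open import Data.Nat using (ℕ; zero; suc; _+_; _*_; _^_; NonZero)
open import Data.Nat.DivMod using (_mod_)
open import Data.Fin using (Fin; toℕ) renaming (zero to fzero; suc to fsuc)
open import Relation.Binary.PropositionalEquality using (_≡_)
open import Data.List using (List; []; _∷_)
open import Data.List.Relation.Unary.All using (All)
open import Data.Product using (_×_; _,_; ∃)

-- Elements of F_p are Fin p = {0,...,p-1}; F_p^n is Fin n → Fin p.
Point : ℕ → ℕ → Set
Point p n = Fin n → Fin p

record Term (p n : ℕ) : Set where
  constructor term
  field
    coeff : Fin p
    expo  : Fin n → ℕ

Poly : ℕ → ℕ → Set
Poly p n = List (Term p n)

sumFin : (n : ℕ) → (Fin n → ℕ) → ℕ
sumFin zero    f = 0
sumFin (suc n) f = f fzero + sumFin n (λ i → f (fsuc i))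

prodFin : (n : ℕ) → (Fin n → ℕ) → ℕ
prodFin zero    f = 1
prodFin (suc n) f = f fzero * prodFin n (λ i → f (fsuc i))

totalDegree : ∀ {p n} → Term p n → ℕ
totalDegree {n = n} t = sumFin n (Term.expo t)

-- f is homogeneous of degree k: every term has total degree k.
-- (Every homogeneous polynomial of degree k admits such a representation,
--  and every such representation is homogeneous of degree k.)
Homogeneous : ∀ {p n} → ℕ → Poly p n → Set
Homogeneous k f = All (λ t → totalDegree t ≡ k) f

-- Evaluation: computed in ℕ then reduced mod p (reduction is a ring hom ℤ → F_p).
evalℕ : ∀ {p n} → Poly p n → Point p n → ℕ
evalℕ [] x = 0
evalℕ {n = n} (term c e ∷ f) x =
  toℕ c * prodFin n (λ i → toℕ (x i) ^ e i) + evalℕ f x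

eval : ∀ {p n} .{{_ : NonZero p}} → Poly p n → Point p n → Fin p
eval f x = evalℕ f x mod _

linePt : ∀ {p n} .{{_ : NonZero p}} → Point p n → Point p n → Fin p → Point p n
linePt x d λ' i = (toℕ (x i) + toℕ λ' * toℕ (d i)) mod _

-- The rectangle T_1 × ⋯ × T_p (indexed by Fin p, T zero = T_1) contains ℓ_{x,d}.
RectContainsLine : ∀ {p n} .{{_ : NonZero p}} →
  (Fin p → Point p n → Set) → Point p n → Point p n → Set
RectContainsLine {p} T x d = ∀ (λ' : Fin p) → T λ' (linePt x d λ')

-- For λ = 0,…,p−1 the points x + λd lie on a line and f(x + λd) is a polynomial in λ
-- of degree ≤ k ≤ p − 1 whose λ^k-coefficient is f(d), by homogeneity. Summing over
-- λ ∈ F_p kills every power λ^j with j < p − 1, so Σ_λ f(x + λd) ≡ c_k f(d) ≡ 0 (mod p).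
-- On a line in Z × S × ⋯ × S, however, the sum is 0 + (p − 1)a ≢ 0.
-- The power sums are handled in the binomial basis: l·C(l,j) = (j+1)C(l,j+1) + j·C(l,j)
-- lowers the degree of one linear factor at a time, Σ_{l<p} C(l,j) = C(p,j+1), and
-- p ∣ C(p,j+1) for j + 1 < p.
module Submission where

open import Defs
open import Data.Nat using (ℕ; zero; suc; _+_; _*_; _^_; _∸_; _%_; _≤_; _<_; s<s⁻¹; z<s;
  NonZero; >-nonZero; >-nonZero⁻¹; nonTrivial⇒n>1)
open import Data.Nat.Properties using (+-identityʳ; +-comm; +-suc; *-zeroʳ; *-identityˡ;
  *-identityʳ; *-comm; *-distribˡ-+; n<1+n; 1+n≢0; ≤-refl; <-trans; ≤-<-trans; m<n⇒m<1+n;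
  ∸-monoʳ-<; n≢0⇒n>0)
open import Data.Nat.DivMod using (_mod_; m%n<n; m%n%n≡m%n; %-distribˡ-+; %-distribˡ-*;
  m*n%n≡0; m<n⇒m%n≡m)
open import Data.Nat.Divisibility using (_∣_; _∤_; divides; ∣m⇒∣m*n; ∣n⇒∣m*n; >⇒∤; n∣m⇒m%n≡0; m%n≡0⇒n∣m)
open import Data.Nat.Primality using (Prime; euclidsLemma; prime⇒nonTrivial)
open import Data.Nat.Combinatorics using (_C_; nC1≡n; nCk+nC[k+1]≡[n+1]C[k+1])
open import Data.Nat.ListAction using (product)
open import Data.Nat.ListAction.Properties using (product-++)
open import Data.Nat.Tactic.RingSolver using (solve-∀)
open import Data.Fin using (Fin; toℕ) renaming (zero to fzero; suc to fsuc)
open import Data.Fin.Properties using (toℕ-fromℕ<; toℕ<n)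
open import Data.List using (List; []; _∷_; _++_; map; replicate; length)
open import Data.List.Properties using (map-++; map-replicate; length-++; length-replicate)
open import Data.List.Relation.Unary.All using ([]; _∷_)
open import Data.Product using (_×_; _,_; Σ; ∃; proj₁; proj₂)
open import Data.Sum using (inj₁; inj₂)
open import Function using (_∘_)
open import Relation.Binary.Bundles using (Setoid)
open import Relation.Binary.PropositionalEquality
  using (_≡_; _≢_; refl; sym; trans; cong; cong₂; subst; module ≡-Reasoning)
open import Relation.Binary.PropositionalEquality.Properties as ≡ using ()
import Relation.Binary.Construct.On as On
import Relation.Binary.Reasoning.Setoid as SetoidReasoning
open import Relation.Nullary using (¬_; contradiction)

sumBelow : ℕ → (ℕ → ℕ) → ℕ
sumBelow zero    h = 0
sumBelow (suc n) h = sumBelow n h + h n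

sumBelow-cong : ∀ n {g h : ℕ → ℕ} → (∀ l → g l ≡ h l) → sumBelow n g ≡ sumBelow n h
sumBelow-cong zero    g≡h = refl
sumBelow-cong (suc n) g≡h = cong₂ _+_ (sumBelow-cong n g≡h) (g≡h n)

sumBelow-+ : ∀ n (g h : ℕ → ℕ) →
  sumBelow n (λ l → g l + h l) ≡ sumBelow n g + sumBelow n h
sumBelow-+ zero    g h = refl
sumBelow-+ (suc n) g h =
  trans (cong (_+ (g n + h n)) (sumBelow-+ n g h)) (interchange (sumBelow n g) (sumBelow n h) (g n) (h n))
  where
  interchange : ∀ a b c d → a + b + (c + d) ≡ a + c + (b + d)
  interchange = solve-∀

*-distribˡ-sumBelow : ∀ n c (h : ℕ → ℕ) → sumBelow n (λ l → c * h l) ≡ c * sumBelow n h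
*-distribˡ-sumBelow zero    c h = sym (*-zeroʳ c)
*-distribˡ-sumBelow (suc n) c h =
  trans (cong (_+ c * h n) (*-distribˡ-sumBelow n c h)) (sym (*-distribˡ-+ c _ (h n)))

sumBelow-zero : ∀ n → sumBelow n (λ _ → 0) ≡ 0
sumBelow-zero zero    = refl
sumBelow-zero (suc n) = trans (+-identityʳ _) (sumBelow-zero n)

pascal : ∀ n k → n C k + n C suc k ≡ suc n C suc k
pascal = nCk+nC[k+1]≡[n+1]C[k+1]

[k+1]*[n+1]C[k+1]≡[n+1]*nCk : ∀ n k → suc k * (suc n C suc k) ≡ suc n * (n C k)
[k+1]*[n+1]C[k+1]≡[n+1]*nCk n zero = trans (*-identityˡ _) (trans (nC1≡n (suc n)) (sym (*-identityʳ _)))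
[k+1]*[n+1]C[k+1]≡[n+1]*nCk zero (suc k) = *-zeroʳ (suc (suc k))
[k+1]*[n+1]C[k+1]≡[n+1]*nCk (suc n) (suc k) = begin
  suc (suc k) * (suc (suc n) C suc (suc k))
    ≡⟨ cong (suc (suc k) *_) (pascal (suc n) (suc k)) ⟨
  suc (suc k) * (suc n C suc k + suc n C suc (suc k))
    ≡⟨ *-distribˡ-+ (suc (suc k)) (suc n C suc k) _ ⟩
  suc n C suc k + suc k * (suc n C suc k) + suc (suc k) * (suc n C suc (suc k))
    ≡⟨ cong₂ (λ a b → suc n C suc k + a + b) ([k+1]*[n+1]C[k+1]≡[n+1]*nCk n k) ([k+1]*[n+1]C[k+1]≡[n+1]*nCk n (suc k)) ⟩
  suc n C suc k + suc n * (n C k) + suc n * (n C suc k)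
    ≡⟨ regroup (suc n C suc k) (n C k) (n C suc k) n ⟩
  suc n C suc k + suc n * (n C k + n C suc k)
    ≡⟨ cong (λ c → suc n C suc k + suc n * c) (pascal n k) ⟩
  suc (suc n) * (suc n C suc k) ∎
  where
  open ≡-Reasoning
  regroup : ∀ a b c n → a + suc n * b + suc n * c ≡ a + suc n * (b + c)
  regroup = solve-∀

n*nCk≡[k+1]*nC[k+1]+k*nCk : ∀ n k → n * (n C k) ≡ suc k * (n C suc k) + k * (n C k)
n*nCk≡[k+1]*nC[k+1]+k*nCk zero    zero    = refl
n*nCk≡[k+1]*nC[k+1]+k*nCk zero    (suc k) = sym (cong₂ _+_ (*-zeroʳ (suc (suc k))) (*-zeroʳ (suc k)))
n*nCk≡[k+1]*nC[k+1]+k*nCk (suc n) zero    =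
  trans (sym ([k+1]*[n+1]C[k+1]≡[n+1]*nCk n 0)) (sym (+-identityʳ _))
n*nCk≡[k+1]*nC[k+1]+k*nCk (suc n) (suc k) = begin
  suc n * (suc n C suc k)                              ≡⟨ cong (suc n *_) (pascal n k) ⟨
  suc n * (n C k + n C suc k)                          ≡⟨ *-distribˡ-+ (suc n) (n C k) _ ⟩
  suc n * (n C k) + suc n * (n C suc k)                ≡⟨ cong₂ _+_ ([k+1]*[n+1]C[k+1]≡[n+1]*nCk n k)
                                                                    ([k+1]*[n+1]C[k+1]≡[n+1]*nCk n (suc k)) ⟨
  suc k * (suc n C suc k) + suc (suc k) * (suc n C suc (suc k)) ≡⟨ +-comm (suc k * (suc n C suc k)) _ ⟩
  suc (suc k) * (suc n C suc (suc k)) + suc k * (suc n C suc k) ∎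
  where open ≡-Reasoning

∑[l<n]lCk≡nC[k+1] : ∀ n k → sumBelow n (_C k) ≡ n C suc k
∑[l<n]lCk≡nC[k+1] zero    k = refl
∑[l<n]lCk≡nC[k+1] (suc n) k =
  trans (cong (_+ n C k) (∑[l<n]lCk≡nC[k+1] n k)) (trans (+-comm (n C suc k) (n C k)) (pascal n k))

prime∣pC[k+1] : ∀ {p k} → Prime p → suc k < p → p ∣ p C suc k
prime∣pC[k+1] {suc n} {k} pp k+1<p
  with euclidsLemma (suc k) (suc n C suc k) pp
         (divides (n C k) (trans ([k+1]*[n+1]C[k+1]≡[n+1]*nCk n k) (*-comm (suc n) (n C k))))
... | inj₁ p∣k+1   = contradiction p∣k+1 (>⇒∤ k+1<p)
... | inj₂ p∣pCk+1 = p∣pCk+1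

prime∤[p∸1]*n : ∀ {p n} → Prime p → 0 < n → n < p → p ∤ (p ∸ 1) * n
prime∤[p∸1]*n {suc p-1} {n} pp 0<n n<p p∣[p∸1]*n
  with euclidsLemma p-1 n pp p∣[p∸1]*n
... | inj₁ p∣p-1 = >⇒∤ {{>-nonZero (s<s⁻¹ (nonTrivial⇒n>1 _ {{prime⇒nonTrivial pp}}))}} (n<1+n p-1) p∣p-1
... | inj₂ p∣n   = >⇒∤ {{>-nonZero 0<n}} n<p p∣n

toℕ-mod : ∀ m n .{{_ : NonZero n}} → toℕ (m mod n) ≡ m % n
toℕ-mod m n = toℕ-fromℕ< (m%n<n m n)

-- A pair (u , v) stands for the linear polynomial u + l·v in the variable l.
LinearFactor : Set
LinearFactor = ℕ × ℕ

_at_ : List LinearFactor → ℕ → ℕ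
L at l = product (map (λ (u , v) → u + l * v) L)

slopes : List LinearFactor → ℕ
slopes L = product (map proj₂ L)

product-replicate : ∀ m y → product (replicate m y) ≡ y ^ m
product-replicate zero    y = refl
product-replicate (suc m) y = cong (y *_) (product-replicate m y)

at-++ : ∀ L M l → (L ++ M) at l ≡ L at l * M at l
at-++ L M l = trans (cong product (map-++ _ L M)) (product-++ (map _ L) _)

at-replicate : ∀ m u v l → replicate m (u , v) at l ≡ (u + l * v) ^ m
at-replicate m u v l = trans (cong product (map-replicate _ m (u , v))) (product-replicate m _)

slopes-++ : ∀ L M → slopes (L ++ M) ≡ slopes L * slopes M
slopes-++ L M = trans (cong product (map-++ proj₂ L M)) (product-++ (map proj₂ L) _)

slopes-replicate : ∀ m u v → slopes (replicate m (u , v)) ≡ v ^ m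
slopes-replicate m u v = trans (cong product (map-replicate proj₂ m (u , v))) (product-replicate m v)

lineFactors : ∀ {n} → (Fin n → ℕ) → (Fin n → ℕ) → (Fin n → ℕ) → List LinearFactor
lineFactors {zero}  u v e = []
lineFactors {suc n} u v e =
  replicate (e fzero) (u fzero , v fzero) ++ lineFactors (u ∘ fsuc) (v ∘ fsuc) (e ∘ fsuc)

lineFactors-at : ∀ {n} (u v e : Fin n → ℕ) l →
  lineFactors u v e at l ≡ prodFin n (λ i → (u i + l * v i) ^ e i)
lineFactors-at {zero}  u v e l = refl
lineFactors-at {suc n} u v e l = trans (at-++ (replicate (e fzero) _) _ l)
  (cong₂ _*_ (at-replicate (e fzero) (u fzero) (v fzero) l) (lineFactors-at (u ∘ fsuc) (v ∘ fsuc) (e ∘ fsuc) l))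

slopes-lineFactors : ∀ {n} (u v e : Fin n → ℕ) → slopes (lineFactors u v e) ≡ prodFin n (λ i → v i ^ e i)
slopes-lineFactors {zero}  u v e = refl
slopes-lineFactors {suc n} u v e = trans (slopes-++ (replicate (e fzero) _) _)
  (cong₂ _*_ (slopes-replicate (e fzero) (u fzero) (v fzero)) (slopes-lineFactors (u ∘ fsuc) (v ∘ fsuc) (e ∘ fsuc)))

length-lineFactors : ∀ {n} (u v e : Fin n → ℕ) → length (lineFactors u v e) ≡ sumFin n e
length-lineFactors {zero}  u v e = refl
length-lineFactors {suc n} u v e = trans (length-++ (replicate (e fzero) _))
  (cong₂ _+_ (length-replicate (e fzero)) (length-lineFactors (u ∘ fsuc) (v ∘ fsuc) (e ∘ fsuc)))

module Modulo (p : ℕ) .{{_ : NonZero p}} where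

  infix 4 _≡ₚ_
  _≡ₚ_ : ℕ → ℕ → Set
  m ≡ₚ n = m % p ≡ n % p

  ≡ₚ-setoid : Setoid _ _
  ≡ₚ-setoid = On.setoid (≡.setoid ℕ) (_% p)

  open Setoid ≡ₚ-setoid public using ()
    renaming (refl to ≡ₚ-refl; trans to ≡ₚ-trans; reflexive to ≡ₚ-reflexive)

  +-congₚ : ∀ {a b c d} → a ≡ₚ b → c ≡ₚ d → a + c ≡ₚ b + d
  +-congₚ {a} {b} {c} {d} a≡b c≡d = begin
    (a + c) % p              ≡⟨ %-distribˡ-+ a c p ⟩
    (a % p + c % p) % p      ≡⟨ cong₂ (λ x y → (x + y) % p) a≡b c≡d ⟩
    (b % p + d % p) % p      ≡⟨ %-distribˡ-+ b d p ⟨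
    (b + d) % p              ∎
    where open ≡-Reasoning

  *-congₚ : ∀ {a b c d} → a ≡ₚ b → c ≡ₚ d → a * c ≡ₚ b * d
  *-congₚ {a} {b} {c} {d} a≡b c≡d = begin
    (a * c) % p              ≡⟨ %-distribˡ-* a c p ⟩
    (a % p * (c % p)) % p    ≡⟨ cong₂ (λ x y → (x * y) % p) a≡b c≡d ⟩
    (b % p * (d % p)) % p    ≡⟨ %-distribˡ-* b d p ⟨
    (b * d) % p              ∎
    where open ≡-Reasoning

  ^-congₚ : ∀ {a b} m → a ≡ₚ b → a ^ m ≡ₚ b ^ m
  ^-congₚ zero    a≡b = refl
  ^-congₚ (suc m) a≡b = *-congₚ a≡b (^-congₚ m a≡b)

  sumBelow-congₚ : ∀ n {g h : ℕ → ℕ} → (∀ l → g l ≡ₚ h l) → sumBelow n g ≡ₚ sumBelow n h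
  sumBelow-congₚ zero    g≡h = refl
  sumBelow-congₚ (suc n) g≡h = +-congₚ (sumBelow-congₚ n g≡h) (g≡h n)

  prodFin-congₚ : ∀ n {g h : Fin n → ℕ} → (∀ i → g i ≡ₚ h i) → prodFin n g ≡ₚ prodFin n h
  prodFin-congₚ zero    g≡h = refl
  prodFin-congₚ (suc n) g≡h = *-congₚ (g≡h fzero) (prodFin-congₚ n (g≡h ∘ fsuc))

  %-≡ₚ : ∀ m → m % p ≡ₚ m
  %-≡ₚ m = m%n%n≡m%n m p

  toℕ-mod≡⇒≡ₚ : ∀ {m b} → toℕ (m mod p) ≡ b → m ≡ₚ b
  toℕ-mod≡⇒≡ₚ {m} eq = trans (sym (m%n%n≡m%n m p)) (cong (_% p) (trans (sym (toℕ-mod m p)) eq))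

  ∣⇒≡ₚ0 : ∀ {m} → p ∣ m → m ≡ₚ 0
  ∣⇒≡ₚ0 {m} p∣m = trans (n∣m⇒m%n≡0 m p p∣m) (sym (m*n%n≡0 0 p))

  ≡ₚ0⇒∣ : ∀ {m} → m ≡ₚ 0 → p ∣ m
  ≡ₚ0⇒∣ {m} m≡0 = m%n≡0⇒n∣m m p (trans m≡0 (m*n%n≡0 0 p))

  momentCoeff : ℕ → ℕ → ℕ
  momentCoeff j zero    = p C suc j
  momentCoeff j (suc m) = suc j * momentCoeff (suc j) m

  binomialMoment : ℕ → List LinearFactor → ℕ
  binomialMoment j L = sumBelow p (λ l → (l C j) * (L at l))

  binomialMoment-∷ : ∀ j u v L →
    binomialMoment j ((u , v) ∷ L) ≡
      u * binomialMoment j L + v * (suc j * binomialMoment (suc j) L) + v * (j * binomialMoment j L)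
  binomialMoment-∷ j u v L = begin
    sumBelow p (λ l → (l C j) * ((u + l * v) * (L at l)))
      ≡⟨ sumBelow-cong p split ⟩
    sumBelow p (λ l → X l + Y l + Z l)
      ≡⟨ trans (sumBelow-+ p (λ l → X l + Y l) Z) (cong (_+ sumBelow p Z) (sumBelow-+ p X Y)) ⟩
    sumBelow p X + sumBelow p Y + sumBelow p Z
      ≡⟨ cong₂ (λ a b → a + b + sumBelow p Z) (*-distribˡ-sumBelow p u _) (pull v (suc j) (suc j)) ⟩
    u * binomialMoment j L + v * (suc j * binomialMoment (suc j) L) + sumBelow p Z
      ≡⟨ cong (u * binomialMoment j L + v * (suc j * binomialMoment (suc j) L) +_) (pull v j j) ⟩
    u * binomialMoment j L + v * (suc j * binomialMoment (suc j) L) + v * (j * binomialMoment j L) ∎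
    where
    open ≡-Reasoning
    X Y Z : ℕ → ℕ
    X l = u * ((l C j) * (L at l))
    Y l = v * (suc j * ((l C suc j) * (L at l)))
    Z l = v * (j * ((l C j) * (L at l)))

    pull : ∀ a b i → sumBelow p (λ l → a * (b * ((l C i) * (L at l)))) ≡ a * (b * binomialMoment i L)
    pull a b i = trans (*-distribˡ-sumBelow p a _) (cong (a *_) (*-distribˡ-sumBelow p b _))

    -- l·C(l,j) = (j+1)·C(l,j+1) + j·C(l,j) absorbs the factor l of l·v.
    split : ∀ l → (l C j) * ((u + l * v) * (L at l)) ≡ X l + Y l + Z l
    split l = begin
      (l C j) * ((u + l * v) * (L at l))                        ≡⟨ expand (l C j) l u v (L at l) ⟩
      X l + v * ((l * (l C j)) * (L at l))                      ≡⟨ cong (λ c → X l + v * (c * (L at l))) (n*nCk≡[k+1]*nC[k+1]+k*nCk l j) ⟩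
      X l + v * ((suc j * (l C suc j) + j * (l C j)) * (L at l)) ≡⟨ collect (l C j) (l C suc j) u v (L at l) j ⟩
      X l + Y l + Z l                                           ∎
      where
      expand : ∀ c l u v P → c * ((u + l * v) * P) ≡ u * (c * P) + v * ((l * c) * P)
      expand = solve-∀
      collect : ∀ c c' u v P j → u * (c * P) + v * ((suc j * c' + j * c) * P) ≡
                                 u * (c * P) + v * (suc j * (c' * P)) + v * (j * (c * P))
      collect = solve-∀

  module _ (p-prime : Prime p) where

    prime∣momentCoeff : ∀ j m → suc (j + m) < p → p ∣ momentCoeff j m
    prime∣momentCoeff j zero    j+1<p = prime∣pC[k+1] p-prime (subst (λ i → suc i < p) (+-identityʳ j) j+1<p)
    prime∣momentCoeff j (suc m) j+m+2<p =
      ∣n⇒∣m*n (suc j) (prime∣momentCoeff (suc j) m (subst (λ i → suc i < p) (+-suc j m) j+m+2<p))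

    -- The terms of binomialMoment-∷ that keep the index j carry a coefficient divisible by p.
    binomialMoment≡ₚ : ∀ j L → j + length L < p → binomialMoment j L ≡ₚ momentCoeff j (length L) * slopes L
    binomialMoment≡ₚ j [] j<p = ≡ₚ-reflexive (begin
      sumBelow p (λ l → (l C j) * 1)  ≡⟨ sumBelow-cong p (λ l → *-identityʳ (l C j)) ⟩
      sumBelow p (_C j)               ≡⟨ ∑[l<n]lCk≡nC[k+1] p j ⟩
      p C suc j                       ≡⟨ *-identityʳ (p C suc j) ⟨
      (p C suc j) * 1                 ∎)
      where open ≡-Reasoning
    binomialMoment≡ₚ j ((u , v) ∷ L) j+m+1<p = begin
      binomialMoment j ((u , v) ∷ L)
        ≡⟨ binomialMoment-∷ j u v L ⟩
      u * Tj + v * (suc j * Tj+1) + v * (j * Tj)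
        ≈⟨ +-congₚ (+-congₚ (*-congₚ (≡ₚ-refl {u}) Tj≡0) (*-congₚ (≡ₚ-refl {v}) (*-congₚ (≡ₚ-refl {suc j}) Tj+1≡)))
                   (*-congₚ (≡ₚ-refl {v}) (*-congₚ (≡ₚ-refl {j}) Tj≡0)) ⟩
      u * 0 + v * (suc j * (momentCoeff (suc j) m * slopes L)) + v * (j * 0)
        ≡⟨ collect u v j (momentCoeff (suc j) m) (slopes L) ⟩
      momentCoeff j (suc m) * slopes ((u , v) ∷ L) ∎
      where
      open SetoidReasoning ≡ₚ-setoid
      m = length L
      Tj = binomialMoment j L
      Tj+1 = binomialMoment (suc j) L
      j+m+1<p' : suc (j + m) < p
      j+m+1<p' = subst (_< p) (+-suc j m) j+m+1<p
      Tj+1≡ : Tj+1 ≡ₚ momentCoeff (suc j) m * slopes L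
      Tj+1≡ = binomialMoment≡ₚ (suc j) L j+m+1<p'
      Tj≡0 : Tj ≡ₚ 0
      Tj≡0 = ≡ₚ-trans (binomialMoment≡ₚ j L (<-trans (n<1+n (j + m)) j+m+1<p'))
                      (∣⇒≡ₚ0 (∣m⇒∣m*n (slopes L) (prime∣momentCoeff j m j+m+1<p')))
      collect : ∀ u v j c V → u * 0 + v * (suc j * (c * V)) + v * (j * 0) ≡ suc j * c * (v * V)
      collect = solve-∀

    ∑-at≡ₚ : ∀ L → length L < p → sumBelow p (L at_) ≡ₚ momentCoeff 0 (length L) * slopes L
    ∑-at≡ₚ L |L|<p = ≡ₚ-trans (≡ₚ-reflexive (sumBelow-cong p (λ l → sym (*-identityˡ (L at l)))))
                              (binomialMoment≡ₚ 0 L |L|<p)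

  sumBelow-zeroThenConst : ∀ {g a} m → g 0 ≡ₚ 0 → (∀ l → suc l < m → g (suc l) ≡ₚ a) →
    sumBelow m g ≡ₚ (m ∸ 1) * a
  sumBelow-zeroThenConst zero          g0 gconst = refl
  sumBelow-zeroThenConst (suc zero)    g0 gconst = g0
  sumBelow-zeroThenConst {g} {a} (suc (suc m)) g0 gconst =
    ≡ₚ-trans (+-congₚ (sumBelow-zeroThenConst (suc m) g0 (λ l l<m → gconst l (m<n⇒m<1+n l<m))) (gconst m ≤-refl))
             (≡ₚ-reflexive (+-comm (m * a) a))

  module Line {n} (x d : Point p n) where

    base slope : Fin n → ℕ
    base i  = toℕ (x i)
    slope i = toℕ (d i)

    restrict : Poly p n → ℕ → ℕ
    restrict []             l = 0
    restrict (term c e ∷ f) l = toℕ c * (lineFactors base slope e at l) + restrict f l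

    linePt≡ₚ : ∀ l i → toℕ (linePt x d (l mod p) i) ≡ₚ base i + l * slope i
    linePt≡ₚ l i = begin
      toℕ (linePt x d (l mod p) i)            ≡⟨ toℕ-mod _ p ⟩
      (base i + toℕ (l mod p) * slope i) % p  ≈⟨ %-≡ₚ _ ⟩
      base i + toℕ (l mod p) * slope i        ≡⟨ cong (λ t → base i + t * slope i) (toℕ-mod l p) ⟩
      base i + (l % p) * slope i              ≈⟨ +-congₚ (≡ₚ-refl {base i}) (*-congₚ (%-≡ₚ l) (≡ₚ-refl {slope i})) ⟩
      base i + l * slope i                    ∎
      where open SetoidReasoning ≡ₚ-setoid

    evalℕ-linePt≡ₚ : ∀ f l → evalℕ f (linePt x d (l mod p)) ≡ₚ restrict f l
    evalℕ-linePt≡ₚ []             l = refl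
    evalℕ-linePt≡ₚ (term c e ∷ f) l = +-congₚ
      (*-congₚ (≡ₚ-refl {toℕ c}) (≡ₚ-trans (prodFin-congₚ n (λ i → ^-congₚ (e i) (linePt≡ₚ l i)))
                                            (≡ₚ-reflexive (sym (lineFactors-at base slope e l)))))
      (evalℕ-linePt≡ₚ f l)

    module _ (p-prime : Prime p) where

      ∑-restrict≡ₚ : ∀ k f → Homogeneous k f → k < p → sumBelow p (restrict f) ≡ₚ momentCoeff 0 k * evalℕ f d
      ∑-restrict≡ₚ k []             []             k<p = ≡ₚ-reflexive (trans (sumBelow-zero p) (sym (*-zeroʳ (momentCoeff 0 k))))
      ∑-restrict≡ₚ k (term c e ∷ f) (deg≡k ∷ hom) k<p = begin
        sumBelow p (restrict (term c e ∷ f))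
          ≡⟨ sumBelow-+ p _ (restrict f) ⟩
        sumBelow p (λ l → toℕ c * (L at l)) + sumBelow p (restrict f)
          ≡⟨ cong (_+ sumBelow p (restrict f)) (*-distribˡ-sumBelow p (toℕ c) (L at_)) ⟩
        toℕ c * sumBelow p (L at_) + sumBelow p (restrict f)
          ≈⟨ +-congₚ (*-congₚ (≡ₚ-refl {toℕ c}) (∑-at≡ₚ p-prime L (subst (_< p) (sym |L|≡k) k<p)))
                     (∑-restrict≡ₚ k f hom k<p) ⟩
        toℕ c * (momentCoeff 0 (length L) * slopes L) + momentCoeff 0 k * evalℕ f d
          ≡⟨ cong₂ (λ m s → toℕ c * (momentCoeff 0 m * s) + momentCoeff 0 k * evalℕ f d)
                   |L|≡k (slopes-lineFactors base slope e) ⟩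
        toℕ c * (momentCoeff 0 k * prodFin n (λ i → slope i ^ e i)) + momentCoeff 0 k * evalℕ f d
          ≡⟨ factor (toℕ c) (momentCoeff 0 k) _ (evalℕ f d) ⟩
        momentCoeff 0 k * evalℕ (term c e ∷ f) d ∎
        where
        open SetoidReasoning ≡ₚ-setoid
        L = lineFactors base slope e
        |L|≡k : length L ≡ k
        |L|≡k = trans (length-lineFactors base slope e) deg≡k
        factor : ∀ c a P E → c * (a * P) + a * E ≡ a * (c * P + E)
        factor = solve-∀

      ∑-along-line≡ₚ : ∀ k f → Homogeneous k f → k < p →
        sumBelow p (λ l → evalℕ f (linePt x d (l mod p))) ≡ₚ momentCoeff 0 k * evalℕ f d
      ∑-along-line≡ₚ k f hom k<p =
        ≡ₚ-trans (sumBelow-congₚ p (evalℕ-linePt≡ₚ f)) (∑-restrict≡ₚ k f hom k<p)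

lemma3p4 : (p n : ℕ) → .{{_ : NonZero p}} → Prime p →
    (f : Poly p n) (k : ℕ) → Homogeneous k f → k ≤ p ∸ 1 →
    (a : Fin p) → toℕ a ≢ 0 → (∃ λ (s : Point p n) → eval f s ≡ a) →
    ¬ (Σ (Point p n) λ x → Σ (Point p n) λ d →
    (toℕ (eval f d) ≡ 0) ×
    RectContainsLine (λ i y → (toℕ i ≡ 0 → toℕ (eval f y) ≡ 0) × (toℕ i ≢ 0 → eval f y ≡ a)) x d)
lemma3p4 p n p-prime f k hom k≤p-1 a a≢0 _ (x , d , fd≡0 , onLine) =
  prime∤[p∸1]*n p-prime (n≢0⇒n>0 a≢0) (toℕ<n a) (≡ₚ0⇒∣ (begin
    (p ∸ 1) * toℕ a                                     ≈⟨ sumBelow-zeroThenConst p value₀ valueₛ ⟨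
    sumBelow p (λ l → evalℕ f (linePt x d (l mod p)))   ≈⟨ ∑-along-line≡ₚ p-prime k f hom k<p ⟩
    momentCoeff 0 k * evalℕ f d                         ≈⟨ *-congₚ (≡ₚ-refl {momentCoeff 0 k}) (toℕ-mod≡⇒≡ₚ fd≡0) ⟩
    momentCoeff 0 k * 0                                 ≡⟨ *-zeroʳ (momentCoeff 0 k) ⟩
    0                                                   ∎))
  where
  open Modulo p
  open Line x d
  open SetoidReasoning ≡ₚ-setoid

  k<p : k < p
  k<p = ≤-<-trans k≤p-1 (∸-monoʳ-< z<s (>-nonZero⁻¹ p))

  value₀ : evalℕ f (linePt x d (0 mod p)) ≡ₚ 0
  value₀ = toℕ-mod≡⇒≡ₚ (proj₁ (onLine (0 mod p)) (trans (toℕ-mod 0 p) (m*n%n≡0 0 p)))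

  valueₛ : ∀ l → suc l < p → evalℕ f (linePt x d (suc l mod p)) ≡ₚ toℕ a
  valueₛ l l+1<p = toℕ-mod≡⇒≡ₚ (cong toℕ (proj₂ (onLine (suc l mod p)) l+1≢0))
    where
    l+1≢0 : toℕ (suc l mod p) ≢ 0
    l+1≢0 eq = 1+n≢0 (trans (sym (m<n⇒m%n≡m l+1<p)) (trans (sym (toℕ-mod (suc l) p)) eq))
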